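{- Let $F(X,Y)$ be a CNF formula, where $X$ and $Y$ are disjoint sets of Boolean variables, and let $G \subseteq F$ be a subset of its clauses. Let $H(Y)$ be a CNF formula depending only on variables of $Y$. Then $\exists X\,[F] \equiv H \wedge \exists X\,[F \setminus G]$ holds if and only if both of the following hold: (1) $F$ implies $H$; and (2) $H \wedge \exists X\,[F] \equiv H \wedge \exists X\,[F \setminus G]$.
   Context: A CNF formula $F = C_1 \wedge \dots \wedge C_k$ is identified with its set of clauses $\{C_1,\dots,C_k\}$, so $F \setminus G$ denotes the conjunction of the clauses of $F$ not in $G$ (the empty set of clauses is the constant $1$). For formulas $F', F''$ that may contain existential quantifiers, $F' \equiv F''$ means that $F'$ and $F''$ take the same truth value under every full assignment to the union of their free (unquantified) variables. Finding such an $H$ is called taking $G$ out of the scope of quantifiers in $\exists X\,[F]$ (partial quantifier elimination), and $H$ is then called a solution. -}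

module Defs where

open import Data.Nat using (ℕ)
open import Data.Fin using (Fin)
open import Data.Bool using (Bool; true; false; not)
open import Data.Sum using (_⊎_; inj₁; inj₂; [_,_])
open import Data.Product using (_×_; Σ)
open import Data.List using (List; filter)
open import Data.List.Relation.Unary.All using (All)
open import Data.List.Relation.Unary.Any using (Any)
open import Data.List.Membership.Propositional using (_∈_)
open import Data.List.Membership.DecPropositional using () renaming (_∈?_ to member?)
open import Relation.Binary.PropositionalEquality using (_≡_)
open import Relation.Nullary using (¬?)
open import Data.Product.Properties using (≡-dec)
open import Data.Sum.Properties using () renaming (≡-dec to ⊎-≡-dec)
open import Data.List.Properties using () renaming (≡-dec to List-≡-dec)
import Data.Fin.Properties as FinP
import Data.Bool.Properties as BoolP
open import Function.Bundles using (_⇔_)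

-- A literal over a variable type V: a variable with a polarity
-- (true = positive literal v, false = negative literal ¬v).
Literal : Set → Set
Literal V = V × Bool

Clause : Set → Set
Clause V = List (Literal V)

CNF : Set → Set
CNF V = List (Clause V)

litTrue : {V : Set} → (V → Bool) → Literal V → Set
litTrue a (v Data.Product., b) = a v ≡ b

clauseTrue : {V : Set} → (V → Bool) → Clause V → Set
clauseTrue a C = Any (litTrue a) C

cnfTrue : {V : Set} → (V → Bool) → CNF V → Set
cnfTrue a F = All (clauseTrue a) F

-- Variables of F(X,Y): X = Fin m, Y = Fin n, disjoint by the sum type.
XY : ℕ → ℕ → Set
XY m n = Fin m ⊎ Fin n

_⊕_ : {m n : ℕ} → (Fin m → Bool) → (Fin n → Bool) → XY m n → Bool
(x ⊕ y) = [ x , y ]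

clause-≟ : {m n : ℕ} → (C D : Clause (XY m n)) → Relation.Nullary.Dec (C ≡ D)
clause-≟ = List-≡-dec (≡-dec (⊎-≡-dec FinP._≟_ FinP._≟_) BoolP._≟_)

_∖_ : {m n : ℕ} → CNF (XY m n) → CNF (XY m n) → CNF (XY m n)
F ∖ G = filter (λ C → ¬? (member? clause-≟ C G)) F

_⊆C_ : {V : Set} → CNF V → CNF V → Set
G ⊆C F = All (λ C → C ∈ F) G

∃X[_] : {m n : ℕ} → CNF (XY m n) → (Fin n → Bool) → Set
∃X[ F ] y = Σ (Fin _ → Bool) (λ x → cnfTrue (x ⊕ y) F)

_implies_ : {m n : ℕ} → CNF (XY m n) → CNF (Fin n) → Set
F implies H = ∀ x y → cnfTrue (x ⊕ y) F → cnfTrue y H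

-- Pointwise in y this is propositional logic: P ⇔ R × Q holds iff P → R and
-- R × P ⇔ R × Q (take P = ∃X[F], Q = ∃X[F ∖ G], R = H), and P → R for all y
-- says precisely that F implies H.
module Submission where

open import Defs
open import Data.Nat using (ℕ)
open import Data.Fin using (Fin)
open import Data.Bool using (Bool)
open import Data.Product using (_×_; _,_; proj₁; proj₂)
open import Function.Bundles using (_⇔_; mk⇔; module Equivalence)
open import Level using (Level)

open Equivalence

private
  variable
    a : Level
    P Q R : Set a

⇔-×ˡ-split : P ⇔ (R × Q) → (P → R) × ((R × P) ⇔ (R × Q))
⇔-×ˡ-split P⇔RQ =
    (λ p → proj₁ (to P⇔RQ p))
  , mk⇔ (λ rp → to P⇔RQ (proj₂ rp)) (λ rq → proj₁ rq , from P⇔RQ rq)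

⇔-×ˡ-merge : (P → R) → (R × P) ⇔ (R × Q) → P ⇔ (R × Q)
⇔-×ˡ-merge P⇒R RP⇔RQ =
  mk⇔ (λ p → to RP⇔RQ (P⇒R p , p)) (λ rq → proj₂ (from RP⇔RQ rq))

implies⇔∃X⇒ : {m n : ℕ} (F : CNF (XY m n)) (H : CNF (Fin n)) →
             F implies H ⇔ (∀ y → ∃X[ F ] y → cnfTrue y H)
implies⇔∃X⇒ F H = mk⇔ (λ F⇒H y (x , Fxy) → F⇒H x y Fxy) (λ ∃F⇒H x y Fxy → ∃F⇒H y (x , Fxy))

proposition2 : (m n : ℕ) (F G : CNF (XY m n)) (H : CNF (Fin n)) → G ⊆C F →
    ((∀ (y : Fin n → Bool) → ∃X[ F ] y ⇔ (cnfTrue y H × ∃X[ F ∖ G ] y))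
    ⇔ ((F implies H)
    × (∀ (y : Fin n → Bool) → (cnfTrue y H × ∃X[ F ] y) ⇔ (cnfTrue y H × ∃X[ F ∖ G ] y))))
proposition2 m n F G H _ = mk⇔
  (λ solution →
      from (implies⇔∃X⇒ F H) (λ y → proj₁ (⇔-×ˡ-split (solution y)))
    , λ y → proj₂ (⇔-×ˡ-split (solution y)))
  (λ (F⇒H , conditional) y →
      ⇔-×ˡ-merge (to (implies⇔∃X⇒ F H) F⇒H y) (conditional y))
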